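{- Let $\Phi$ be a systematic $(m,n,s,2)$-scheme and let $G_\Phi$ be a pseudo-graph associated with $\Phi$. Let $C$ be a cycle in $G_\Phi$ starting at vertex $v$, of length $|C|$, and let $b\in\{0,1\}$. Then there are disjoint subsets $S_0,S_1\subseteq \mathrm{lab}(C)$, each with at most $|C|+1$ elements, such that in any representation under $\Phi$ of a set $S$ with $S_1\subseteq S\subseteq [m]\setminus S_0$, the memory location corresponding to $v$ must be assigned $b$. Further, if $b=0$ then $|S_1|=|C|-1$, and if $b=1$ then $|S_1|=|C|+1$.
   Context: An $(m,n,s,2)$-scheme consists of a map $\phi$ assigning to each $S\subseteq[m]$ with $|S|\le n$ an $s$-bit string (its representation) and, for each $x\in[m]$, a decision tree of depth at most $2$ probing bits of the string, such that the tree for $x$ outputs Yes on $\phi(S)$ iff $x\in S$. It is systematic if each tree outputs the last bit it reads ($1$ = Yes). For such a scheme $\Phi$, each query for $x$ first probes a location $c(x)\in[s]$, and then probes location $j(x)$ if the first bit is $0$ and location $k(x)$ if it is $1$. The bipartite multigraph $H_\Phi$ has vertex sets $A_0=\{A_0[1],\dots,A_0[s]\}$ and $A_1=\{A_1[1],\dots,A_1[s]\}$ (vertex $A_0[j]$ and $A_1[j]$ both correspond to memory location $j$), and for each $x\in[m]$ an edge $\{A_0[j(x)],A_1[k(x)]\}$ with label $x$ and colour $c(x)$. A pseudo-graph $G_\Phi$ has the same vertices; its edges are obtained as follows: for each colour $\alpha$, the edges of $H_\Phi$ of colour $\alpha$ are partitioned into ordered pairs (omitting one edge if their number is odd), and for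 each pair $(e,e')$ with $e=\{u,v\}$ labelled $x$, $e'=\{u',v'\}$ labelled $x'$, $u,u'\in A_0$, $v,v'\in A_1$, the edge $\{u,v'\}$ with label $\{(u,x),(v',x')\}$ is included in $G_\Phi$. For a set $P$ of edges of $G_\Phi$, $\mathrm{lab}(P)\subseteq[m]$ is the set of elements of $[m]$ appearing in the label of some edge of $P$. -}

module Defs where

open import Data.Nat using (ℕ; suc; _≤_)
open import Data.Bool using (Bool; true; false; if_then_else_)
open import Data.Fin using (Fin; zero; suc; inject₁)
open import Data.Fin.Subset using (Subset; ∣_∣) renaming (_∈_ to _∈ˢ_; _⊆_ to _⊆ˢ_)
open import Data.Vec using (Vec; lookup)
open import Data.List using (List; length; _∷_; []; concatMap)
import Data.List.Relation.Unary.All as ListAll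
open import Data.List.Relation.Unary.Unique.Propositional using (Unique)
open import Data.List.Membership.Propositional using () renaming (_∉_ to _∉ˡ_)
open import Data.Product using (Σ; ∃; _×_; _,_; proj₁; proj₂)
open import Data.Sum using (_⊎_)
open import Data.Empty using (⊥)
open import Relation.Binary.PropositionalEquality using (_≡_)
open import Function.Definitions using (Injective)

-- A systematic (m,n,s,2)-scheme in the normal form of the paper:
-- the query for x reads location c x; if that bit is 0 it reads j x,
-- if it is 1 it reads k x, and outputs the last bit read (true = 1 = Yes).
-- The representation map φ is given as a total function on all subsets of
-- [m], but is only constrained (and only used) on sets of size ≤ n.
query : ∀ {m s} → (Fin m → Fin s) → (Fin m → Fin s) → (Fin m → Fin s) →
        Fin m → Vec Bool s → Bool
query c j k x w = if lookup w (c x) then lookup w (k x) else lookup w (j x)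

record Scheme (m n s : ℕ) : Set where
  field
    φ : Subset m → Vec Bool s
    c : Fin m → Fin s
    j : Fin m → Fin s
    k : Fin m → Fin s
    correct : (S : Subset m) → ∣ S ∣ ≤ n → (x : Fin m) →
              query c j k x (φ S) ≡ lookup S x

Vertex : ℕ → Set
Vertex s = Bool × Fin s

A₀ A₁ : ∀ {s} → Fin s → Vertex s
A₀ l = false , l
A₁ l = true , l

loc : ∀ {s} → Vertex s → Fin s
loc = proj₂

flat : ∀ {m} → List (Fin m × Fin m) → List (Fin m)
flat = concatMap (λ p → proj₁ p ∷ proj₂ p ∷ [])

-- A pseudo-graph G_Φ is determined by the chosen ordered pairs (x , x'):
-- pairs consist of edges (elements) of the same colour, every element is
-- used at most once, and in each colour at most one element is left out.
record PseudoGraph {m n s : ℕ} (Φ : Scheme m n s) : Set where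
  open Scheme Φ
  field
    pairs      : List (Fin m × Fin m)
    sameColour : ListAll.All (λ p → c (proj₁ p) ≡ c (proj₂ p)) pairs
    disjoint   : Unique (flat pairs)
    maximal    : (x y : Fin m) → c x ≡ c y →
                 x ∉ˡ flat pairs → y ∉ˡ flat pairs → x ≡ y

module _ {m n s : ℕ} {Φ : Scheme m n s} (G : PseudoGraph Φ) where
  open Scheme Φ
  open PseudoGraph G

  Edge : Set
  Edge = Fin (length pairs)

  pairOf : Edge → Fin m × Fin m
  pairOf e = Data.List.lookup pairs e

  end₀ end₁ : Edge → Vertex s
  end₀ e = A₀ (j (proj₁ (pairOf e)))
  end₁ e = A₁ (k (proj₂ (pairOf e)))

  InLabel : Fin m → Edge → Set
  InLabel x e = (x ≡ proj₁ (pairOf e)) ⊎ (x ≡ proj₂ (pairOf e))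

  Joins : Edge → Vertex s → Vertex s → Set
  Joins e a b = (a ≡ end₀ e × b ≡ end₁ e) ⊎ (a ≡ end₁ e × b ≡ end₀ e)

  record Cycle (v : Vertex s) (len : ℕ) : Set where
    field
      nonempty  : 1 ≤ len
      vert      : Fin (suc len) → Vertex s
      edge      : Fin len → Edge
      start     : vert zero ≡ v
      close     : vert (Data.Fin.fromℕ len) ≡ v
      joins     : (i : Fin len) → Joins (edge i) (vert (inject₁ i)) (vert (suc i))
      edgesDist : Injective _≡_ _≡_ edge
      vertsDist : Injective _≡_ _≡_ (λ (i : Fin len) → vert (inject₁ i))

  InLab : ∀ {v len} → Cycle v len → Fin m → Set
  InLab C x = ∃ λ i → InLabel x (Cycle.edge C i)

Disjointˢ : ∀ {m} → Subset m → Subset m → Set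
Disjointˢ P Q = ∀ x → x ∈ˢ P → x ∈ˢ Q → ⊥

-- Each edge of G_Φ comes from two same-coloured elements x, x' whose queries
-- share the first probe c x = c x'; whatever that bit is, one of the two
-- queries reads its answer directly at an endpoint of the edge.  So in every
-- representation of S one endpoint of the edge stores its label's
-- membership bit.  Along the cycle v = w₀, w₁, …, w_len = v take S₁ to be
-- the labels at w₀ of the first edge and at the far ends of all edges, and
-- S₀ the near-end labels of the remaining edges (roles swapped for b = 0).
-- If w₀ does not store b, the first edge forces w₁ to store b, and then
-- each further edge propagates b to the next vertex, until it returns to v.
module Submission where

open import Defs
open import Data.Nat using (ℕ; zero; suc; _≤_)
open import Data.Nat.Properties using (≤-reflexive; ≤-trans; m≤n+m)
open import Data.Bool using (Bool; true; false; not; _xor_)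
open import Data.Bool.Properties using (not-injective; xor-comm; not-¬)
open import Data.Fin using (Fin; zero; suc; inject₁; fromℕ)
open import Data.Fin.Properties using (suc-injective)
open import Data.Fin.Subset
  using (Subset; ∣_∣; _∈_; _∉_; _⊆_; ⊥; ⁅_⁆; _∪_; inside; outside)
open import Data.Fin.Subset.Properties
  using (∉⊥; x∈⁅x⁆; x∈⁅y⁆⇒x≡y; x∈p∪q⁺; x∈p∪q⁻; ∪-identityˡ; ∣⊥∣≡0; drop-not-there)
open import Data.Vec using (lookup; _∷_; here)
open import Data.Vec.Properties using ([]=⇒lookup; lookup⇒[]=)
import Data.Vec.Functional as Vector
open import Data.List as List using (List; length; _∷_)
import Data.List.Relation.Unary.All as All
open import Data.List.Relation.Unary.Any as Any using ()
open import Data.List.Relation.Unary.AllPairs using (_∷_)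
open import Data.List.Relation.Unary.Unique.Propositional using (Unique)
open import Data.List.Membership.Propositional using () renaming (_∈_ to _∈ˡ_; _∉_ to _∉ˡ_)
open import Data.List.Membership.Propositional.Properties using (∈-lookup)
open import Data.Product using (Σ; ∃; _×_; _,_; proj₁; proj₂)
open import Data.Sum using (_⊎_; inj₁; inj₂; [_,_])
open import Data.Empty using (⊥-elim)
open import Relation.Binary.PropositionalEquality
  using (_≡_; refl; sym; trans; cong; subst)
open import Function using (_∘_; id)
open import Function.Definitions using (Injective)

component : {A : Set} → Bool → A × A → A
component false = proj₁
component true  = proj₂

xorʳ-injective : ∀ o {c c′} → c xor o ≡ c′ xor o → c ≡ c′
xorʳ-injective o {c} {c′} eq = cancel o (trans (xor-comm o c) (trans eq (xor-comm c′ o)))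
  where
  cancel : ∀ o {c c′} → o xor c ≡ o xor c′ → c ≡ c′
  cancel false eq = eq
  cancel true  eq = not-injective eq

component∈flat : ∀ {m} (ps : List (Fin m × Fin m)) (p : Fin (length ps)) c →
                 component c (List.lookup ps p) ∈ˡ flat ps
component∈flat (_ ∷ ps) zero    false = Any.here refl
component∈flat (_ ∷ ps) zero    true  = Any.there (Any.here refl)
component∈flat (_ ∷ ps) (suc p) c     = Any.there (Any.there (component∈flat ps p c))

component∉tail : ∀ {m} {a b : Fin m} {xs} → Unique (a ∷ b ∷ xs) → ∀ c → component c (a , b) ∉ˡ xs
component∉tail (a∉ ∷ _)        false x∈ = All.lookup a∉ (Any.there x∈) refl
component∉tail (_ ∷ (b∉ ∷ _)) true  x∈ = All.lookup b∉ x∈ refl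

flat-component-injective :
  ∀ {m} (ps : List (Fin m × Fin m)) → Unique (flat ps) → ∀ {p q c c′} →
  component c (List.lookup ps p) ≡ component c′ (List.lookup ps q) → p ≡ q × c ≡ c′
flat-component-injective (_ ∷ ps) u {zero} {zero} {false} {false} _ = refl , refl
flat-component-injective (_ ∷ ps) u {zero} {zero} {true}  {true}  _ = refl , refl
flat-component-injective (_ ∷ ps) (a∉ ∷ _) {zero} {zero} {false} {true} eq =
  ⊥-elim (All.lookup a∉ (Any.here refl) eq)
flat-component-injective (_ ∷ ps) (a∉ ∷ _) {zero} {zero} {true} {false} eq =
  ⊥-elim (All.lookup a∉ (Any.here refl) (sym eq))
flat-component-injective (_ ∷ ps) u {zero} {suc q} {c} {c′} eq =
  ⊥-elim (component∉tail u c (subst (_∈ˡ flat ps) (sym eq) (component∈flat ps q c′)))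
flat-component-injective (_ ∷ ps) u {suc p} {zero} {c} {c′} eq =
  ⊥-elim (component∉tail u c′ (subst (_∈ˡ flat ps) eq (component∈flat ps p c)))
flat-component-injective (_ ∷ ps) (_ ∷ (_ ∷ u)) {suc p} {suc q} eq
  with flat-component-injective ps u {p} {q} eq
... | refl , c≡c′ = refl , c≡c′

image : ∀ {m k} → (Fin k → Fin m) → Subset m
image {k = zero}  f = ⊥
image {k = suc k} f = ⁅ f zero ⁆ ∪ image (f ∘ suc)

∈-image : ∀ {m k} (f : Fin k → Fin m) i → f i ∈ image f
∈-image f zero    = x∈p∪q⁺ (inj₁ (x∈⁅x⁆ (f zero)))
∈-image f (suc i) = x∈p∪q⁺ (inj₂ (∈-image (f ∘ suc) i))

∈-image⁻ : ∀ {m k} (f : Fin k → Fin m) {y} → y ∈ image f → ∃ λ i → f i ≡ y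
∈-image⁻ {k = zero}  f y∈ = ⊥-elim (∉⊥ y∈)
∈-image⁻ {k = suc k} f y∈ with x∈p∪q⁻ ⁅ f zero ⁆ (image (f ∘ suc)) y∈
... | inj₁ y∈⁅⁆ = zero , sym (x∈⁅y⁆⇒x≡y (f zero) y∈⁅⁆)
... | inj₂ y∈′  with ∈-image⁻ (f ∘ suc) y∈′
...   | i , fi≡y = suc i , fi≡y

∣⁅x⁆∪p∣≡1+∣p∣ : ∀ {m} {x : Fin m} (p : Subset m) → x ∉ p → ∣ ⁅ x ⁆ ∪ p ∣ ≡ suc ∣ p ∣
∣⁅x⁆∪p∣≡1+∣p∣ {x = zero}  (outside ∷ p) _  = cong (suc ∘ ∣_∣) (∪-identityˡ p)
∣⁅x⁆∪p∣≡1+∣p∣ {x = zero}  (inside  ∷ p) x∉ = ⊥-elim (x∉ here)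
∣⁅x⁆∪p∣≡1+∣p∣ {x = suc x} (outside ∷ p) x∉ = ∣⁅x⁆∪p∣≡1+∣p∣ p (drop-not-there x∉)
∣⁅x⁆∪p∣≡1+∣p∣ {x = suc x} (inside  ∷ p) x∉ = cong suc (∣⁅x⁆∪p∣≡1+∣p∣ p (drop-not-there x∉))

∣image∣≡ : ∀ {m k} (f : Fin k → Fin m) → Injective _≡_ _≡_ f → ∣ image f ∣ ≡ k
∣image∣≡ {m} {zero}  f _   = ∣⊥∣≡0 m
∣image∣≡ {m} {suc k} f inj =
  trans (∣⁅x⁆∪p∣≡1+∣p∣ (image (f ∘ suc)) f0∉) (cong suc (∣image∣≡ (f ∘ suc) (suc-injective ∘ inj)))
  where
  f0∉ : f zero ∉ image (f ∘ suc)
  f0∉ f0∈ with ∈-image⁻ (f ∘ suc) f0∈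
  ... | i , eq with inj eq
  ...   | ()

∉⇒lookup≡outside : ∀ {m} {p : Subset m} {x} → x ∉ p → lookup p x ≡ outside
∉⇒lookup≡outside {p = p} {x} x∉ with lookup p x in eq
... | outside = refl
... | inside  = ⊥-elim (x∉ (lookup⇒[]= x p eq))

propagate : ∀ {X : Set} (P : X → Set) L (w : Fin (suc L) → X) →
            ((i : Fin L) → P (w (inject₁ i)) → P (w (suc i))) → P (w zero) → P (w (fromℕ L))
propagate P zero    w step = id
propagate P (suc L) w step = propagate P L (w ∘ suc) (step ∘ suc) ∘ step zero

Takes : ∀ {m} → Subset m → Bool → Subset m → Set
Takes S β X = ∀ {y} → y ∈ X → lookup S y ≡ β

⊆⇒Takes-inside : ∀ {m} {S X : Subset m} → X ⊆ S → Takes S inside X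
⊆⇒Takes-inside X⊆S = []=⇒lookup ∘ X⊆S

disjoint⇒Takes-outside : ∀ {m} {S X : Subset m} → (∀ x → x ∈ S → x ∉ X) → Takes S outside X
disjoint⇒Takes-outside disj y∈X = ∉⇒lookup≡outside (λ y∈S → disj _ y∈S y∈X)

module _ {m n s : ℕ} (Φ : Scheme m n s) where
  open Scheme Φ

  pair-constraint :
    ∀ {S} → ∣ S ∣ ≤ n → ∀ {x x′} → c x ≡ c x′ →
    lookup (φ S) (j x) ≡ lookup S x ⊎ lookup (φ S) (k x′) ≡ lookup S x′
  pair-constraint {S} h {x} {x′} same
    with lookup (φ S) (c x) in bit | lookup (φ S) (c x′) in bit′ | correct S h x | correct S h x′
  ... | false | _     | answer | _       = inj₁ answer
  ... | true  | true  | _      | answer′ = inj₂ answer′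
  ... | true  | false | _      | _       with trans (sym bit) (trans (cong (lookup (φ S)) same) bit′)
  ...   | ()

  module _ (G : PseudoGraph Φ) where
    open PseudoGraph G

    orientation : ∀ {e a b} → Joins G e a b → Bool
    orientation (inj₁ _) = false
    orientation (inj₂ _) = true

    edge-constraint :
      ∀ {S} → ∣ S ∣ ≤ n → ∀ {e a b} (J : Joins G e a b) →
      lookup (φ S) (loc a) ≡ lookup S (component (orientation J) (pairOf G e)) ⊎
      lookup (φ S) (loc b) ≡ lookup S (component (not (orientation J)) (pairOf G e))
    edge-constraint h {e} (inj₁ (refl , refl)) =
      pair-constraint h (All.lookup sameColour (∈-lookup e))
    edge-constraint h {e} (inj₂ (refl , refl))
      with pair-constraint h (All.lookup sameColour (∈-lookup e))
    ... | inj₁ near = inj₂ near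
    ... | inj₂ far  = inj₁ far

    module _ {v : Vertex s} {L : ℕ} (C : Cycle G v (suc L)) where
      open Cycle C

      -- endLabel false i and endLabel true i are the labels of edge i at
      -- vert (inject₁ i) and at vert (suc i) respectively.
      endLabel : Bool → Fin (suc L) → Fin m
      endLabel c i = component (c xor orientation (joins i)) (pairOf G (edge i))

      endLabel-injective : ∀ c i c′ i′ → endLabel c i ≡ endLabel c′ i′ → i ≡ i′ × c ≡ c′
      endLabel-injective c i c′ i′ eq
        with flat-component-injective pairs disjoint
               {edge i} {edge i′} {c xor orientation (joins i)} {c′ xor orientation (joins i′)} eq
      ... | eᵢ≡eᵢ′ , same with edgesDist {i} {i′} eᵢ≡eᵢ′
      ...   | refl = refl , xorʳ-injective (orientation (joins i)) same

      endLabel∈lab : ∀ c i → InLab G C (endLabel c i)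
      endLabel∈lab c i = i , side (c xor orientation (joins i))
        where
        side : ∀ c′ → InLabel G (component c′ (pairOf G (edge i))) (edge i)
        side false = inj₁ refl
        side true  = inj₂ refl

      nearLabel : Fin L → Fin m
      nearLabel i = endLabel false (suc i)

      forcingLabel : Fin (suc (suc L)) → Fin m
      forcingLabel = endLabel false zero Vector.∷ endLabel true

      nearLabels forcingLabels : Subset m
      nearLabels    = image nearLabel
      forcingLabels = image forcingLabel

      ∣nearLabels∣≡ : ∣ nearLabels ∣ ≡ L
      ∣nearLabels∣≡ = ∣image∣≡ nearLabel
        (λ {i} {i′} → suc-injective ∘ proj₁ ∘ endLabel-injective false (suc i) false (suc i′))

      ∣forcingLabels∣≡ : ∣ forcingLabels ∣ ≡ suc (suc L)
      ∣forcingLabels∣≡ = ∣image∣≡ forcingLabel injective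
        where
        injective : Injective _≡_ _≡_ forcingLabel
        injective {zero}  {zero}  _  = refl
        injective {zero}  {suc i} eq with endLabel-injective false zero true i eq
        ... | _ , ()
        injective {suc i} {zero}  eq with endLabel-injective true i false zero eq
        ... | _ , ()
        injective {suc i} {suc i′} eq = cong suc (proj₁ (endLabel-injective true i true i′ eq))

      nearLabels⊆lab : ∀ x → x ∈ nearLabels → InLab G C x
      nearLabels⊆lab x x∈ with ∈-image⁻ nearLabel x∈
      ... | i , refl = endLabel∈lab false (suc i)

      forcingLabels⊆lab : ∀ x → x ∈ forcingLabels → InLab G C x
      forcingLabels⊆lab x x∈ with ∈-image⁻ forcingLabel x∈
      ... | zero  , refl = endLabel∈lab false zero
      ... | suc i , refl = endLabel∈lab true i

      near-forcing-disjoint : Disjointˢ nearLabels forcingLabels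
      near-forcing-disjoint x x∈near x∈forcing
        with ∈-image⁻ nearLabel x∈near | ∈-image⁻ forcingLabel x∈forcing
      ... | i , refl | zero  , eq with endLabel-injective false zero false (suc i) eq
      ...   | () , _
      near-forcing-disjoint x _ _ | i , refl | suc i′ , eq
        with endLabel-injective true i′ false (suc i) eq
      ...   | _ , ()

      cycle-forces : ∀ {S} → ∣ S ∣ ≤ n → ∀ b →
                     Takes S b forcingLabels → Takes S (not b) nearLabels →
                     lookup (φ S) (loc v) ≡ b
      cycle-forces {S} h b forcing near =
        [ (λ first  → atStart   (trans first  (forcing (∈-image forcingLabel zero))))
        , (λ second → viaSecond (trans second (forcing (∈-image forcingLabel (suc zero)))))
        ] (edge-constraint h (joins zero))
        where
        Stores : Vertex s → Set
        Stores w = lookup (φ S) (loc w) ≡ b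

        atStart : Stores (vert zero) → Stores v
        atStart = subst Stores start

        step : (i : Fin L) → Stores (vert (suc (inject₁ i))) → Stores (vert (suc (suc i)))
        step i stored with edge-constraint h (joins (suc i))
        ... | inj₁ nearEnd =
          ⊥-elim (not-¬ refl (trans (sym stored) (trans nearEnd (near (∈-image nearLabel i)))))
        ... | inj₂ farEnd  = trans farEnd (forcing (∈-image forcingLabel (suc (suc i))))

        viaSecond : Stores (vert (suc zero)) → Stores v
        viaSecond = subst Stores close ∘ propagate Stores L (vert ∘ suc) step

lemma3 : {m n s : ℕ} (Φ : Scheme m n s) (G : PseudoGraph Φ)
         (v : Vertex s) (len : ℕ) (C : Cycle G v len) (b : Bool) →
         Σ (Subset m) λ S₀ → Σ (Subset m) λ S₁ →
           (∀ x → x ∈ S₀ → InLab G C x) ×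
           (∀ x → x ∈ S₁ → InLab G C x) ×
           Disjointˢ S₀ S₁ ×
           ∣ S₀ ∣ ≤ suc len ×
           ∣ S₁ ∣ ≤ suc len ×
           ((S : Subset m) → ∣ S ∣ ≤ n → S₁ ⊆ S → (∀ x → x ∈ S → x ∉ S₀) →
             lookup (Scheme.φ Φ S) (loc v) ≡ b) ×
           (b ≡ false → suc ∣ S₁ ∣ ≡ len) ×
           (b ≡ true → ∣ S₁ ∣ ≡ suc len)
lemma3 Φ G v zero C b with Cycle.nonempty C
... | ()
lemma3 Φ G v (suc L) C true =
  nearLabels Φ G C , forcingLabels Φ G C ,
  nearLabels⊆lab Φ G C , forcingLabels⊆lab Φ G C , near-forcing-disjoint Φ G C ,
  ≤-trans (≤-reflexive (∣nearLabels∣≡ Φ G C)) (m≤n+m L 2) ,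
  ≤-reflexive (∣forcingLabels∣≡ Φ G C) ,
  (λ S h S₁⊆S S∩S₀=∅ →
     cycle-forces Φ G C h true (⊆⇒Takes-inside S₁⊆S) (disjoint⇒Takes-outside S∩S₀=∅)) ,
  (λ ()) ,
  (λ _ → ∣forcingLabels∣≡ Φ G C)
lemma3 Φ G v (suc L) C false =
  forcingLabels Φ G C , nearLabels Φ G C ,
  forcingLabels⊆lab Φ G C , nearLabels⊆lab Φ G C ,
  (λ x x∈forcing x∈near → near-forcing-disjoint Φ G C x x∈near x∈forcing) ,
  ≤-reflexive (∣forcingLabels∣≡ Φ G C) ,
  ≤-trans (≤-reflexive (∣nearLabels∣≡ Φ G C)) (m≤n+m L 2) ,
  (λ S h S₁⊆S S∩S₀=∅ →
     cycle-forces Φ G C h false (disjoint⇒Takes-outside S∩S₀=∅) (⊆⇒Takes-inside S₁⊆S)) ,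
  (λ _ → cong suc (∣nearLabels∣≡ Φ G C)) ,
  (λ ())
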